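{- For a positive integer $m$, let $H_m$ be the poset with elements $x_1,\dots,x_m,y_1,\dots,y_m$ whose only strict relations are $x_i< y_j$ for all $1\leq i\leq j\leq m$. Then for every fixed $m$, $La^*(n,H_m)\geq (m-1-o(1))\binom{n}{\lfloor n/2\rfloor}$ as $n\to\infty$.
   Context: $La^*(n,H)$ denotes the largest size of a family $\mathcal{F}\subseteq 2^{[n]}$ (ordered by $\subseteq$) that does not contain $H$ as an induced subposet, where a poset $G=(S,\leq)$ contains $H=(S',\leq')$ as an induced subposet if there is an injection $f:S'\to S$ such that for all $u,v\in S'$, $u\leq' v$ if and only if $f(u)\leq f(v)$. -}

module Defs where

open import Data.Nat using (ℕ; zero; suc; _+_; _*_; _∸_; _≤_; _/_)
open import Data.Nat.Combinatorics using (_C_)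
open import Data.Fin as Fin using (Fin)
open import Data.Fin.Subset using (Subset; _⊆_)
open import Data.Sum using (_⊎_; inj₁; inj₂)
open import Data.Product using (Σ; _×_; ∃-syntax)
open import Data.List using (List; length)
open import Data.List.Membership.Propositional using (_∈_)
open import Data.List.Relation.Unary.Unique.Propositional using (Unique)
open import Relation.Binary.PropositionalEquality using (_≡_)
open import Relation.Nullary using (¬_)
open import Function.Definitions using (Injective)
open import Function.Bundles using (_⇔_)

-- A family 𝓕 ⊆ 2^[n] is a duplicate-free list of subsets of Fin n,
-- ordered by inclusion ⊆.
InducedIn : ∀ {n} {S : Set} (R : S → S → Set) (F : List (Subset n)) → Set
InducedIn {n} {S} R F =
  Σ (S → Subset n) λ f →
    (∀ u → f u ∈ F) × Injective _≡_ _≡_ f × (∀ u v → R u v ⇔ (f u ⊆ f v))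

data HLe (m : ℕ) : Fin m ⊎ Fin m → Fin m ⊎ Fin m → Set where
  le-refl : ∀ a → HLe m a a
  le-xy   : ∀ {i j : Fin m} → i Fin.≤ j → HLe m (inj₁ i) (inj₂ j)

-- La*(n,H) ≥ k  (La* is a maximum over a finite set, so this says:
-- some H-induced-free family in 2^[n] has at least k members).
LaStar≥ : ∀ {S : Set} (R : S → S → Set) (n k : ℕ) → Set
LaStar≥ R n k =
  ∃[ F ] (Unique F × ¬ InducedIn {n} R F × k ≤ length F)

-- (k+1) · La*(n,H) ≥ c ·  — used to encode rational lower bounds.
-- We state: some induced-H-free family F in 2^[n] has  c ≤ (k+1)·|F|.
LaStarScaled≥ : ∀ {S : Set} (R : S → S → Set) (n k c : ℕ) → Set
LaStarScaled≥ R n k c =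
  ∃[ F ] (Unique F × ¬ InducedIn {n} R F × c ≤ suc k * length F)

-- Take the L = m - 1 consecutive levels of sizes h, …, h + L - 1, where
-- h = ⌊n/2⌋. An induced copy of H_m would give a chain
-- x₁ ⊊ x₁ ∪ x₂ ⊊ … ⊊ x₁ ∪ … ∪ x_m ⊆ y_m, since x_{i+1} ⊈ y_i ⊇ x₁ ∪ … ∪ x_i;
-- so it spans L + 1 levels, and the family is H_m-free. The identity (k+1) C(n,k+1) = (n-k) C(n,k) shows that
-- C(n, h+i) - C(n, h+i+1) ≤ (2i+1)/(h+1) · C(n, h); summing these losses,
-- C(n, h+j) ≥ (1 - j²/(h+1)) C(n, h) ≥ (1 - m²/(h+1)) C(n, h) for every j < m.
module Submission where

open import Defs
open import Data.Nat using (ℕ; zero; suc; _+_; _*_; _∸_; _≤_; _<_; z≤n; s≤s; s≤s⁻¹; _/_; _%_; NonZero)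
open import Data.Nat.Properties
open import Data.Nat.DivMod using (m≡m%n+[m/n]*n; m%n<n; m/n*n≤m; m*n/n≡m; /-monoˡ-≤)
open import Data.Nat.Combinatorics using (_C_; nC1≡n; nCk+nC[k+1]≡[n+1]C[k+1])
open import Data.Nat.Tactic.RingSolver using (solve-∀)
open import Data.Bool using (Bool)
open import Data.Fin as Fin using (Fin; toℕ; fromℕ; fromℕ<)
open import Data.Fin.Properties using (toℕ-fromℕ; toℕ-fromℕ<)
open import Data.Fin.Subset using (Subset; _⊆_; ∣_∣; inside; outside; _∪_)
open import Data.Fin.Subset.Properties
  using (p⊆p∪q; q⊆p∪q; x∈p∪q⁻; drop-∷-⊆; s⊆s; p⊆q⇒∣p∣≤∣q∣; ⊆-trans)
open import Data.Vec using ([]; _∷_; here)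
open import Data.List using (List; []; [_]; map; _++_; length)
open import Data.List.Properties using (length-map; length-++)
open import Data.List.Membership.Propositional using (_∈_)
open import Data.List.Membership.Propositional.Properties using (∈-map⁻; ∈-++⁻)
open import Data.List.Relation.Unary.Any using (here)
open import Data.List.Relation.Unary.Unique.Propositional using (Unique)
open import Data.List.Relation.Unary.Unique.Propositional.Properties using (map⁺; ++⁺)
import Data.List.Relation.Unary.AllPairs as AllPairs
import Data.List.Relation.Unary.All as All
open import Data.Product using (Σ-syntax; ∃-syntax; _×_; _,_; proj₁; proj₂; map₂)
open import Data.Sum using (_⊎_; inj₁; inj₂)
open import Data.Empty using (⊥-elim)
open import Function.Bundles using (_⇔_; Equivalence)
open import Relation.Binary.PropositionalEquality
  using (_≡_; refl; sym; trans; cong; cong₂; subst; subst₂; module ≡-Reasoning)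
open import Relation.Nullary using (¬_)

shrink-multiplier : ∀ {t T x y c} → t ≤ T → y ≤ x → T * x ≤ T * y + c → t * x ≤ t * y + c
shrink-multiplier {t} {T} {x} {y} {c} t≤T y≤x Tx≤Ty+c with m≤n⇒∃[o]m+o≡n y≤x
... | d , refl = begin
  t * (y + d)   ≡⟨ *-distribˡ-+ t y d ⟩
  t * y + t * d ≤⟨ +-monoʳ-≤ (t * y) (≤-trans (*-monoˡ-≤ d t≤T) Td≤c) ⟩
  t * y + c     ∎
  where
  open ≤-Reasoning
  Td≤c : T * d ≤ c
  Td≤c = +-cancelˡ-≤ (T * y) _ _ (subst (_≤ T * y + c) (*-distribˡ-+ T y d) Tx≤Ty+c)

telescope : ∀ (b : ℕ → ℕ) T c → (∀ i → T * b i ≤ T * b (suc i) + suc (i + i) * c) →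
  ∀ j → T * b 0 ≤ T * b j + j * j * c
telescope b T c step zero    = m≤m+n (T * b 0) 0
telescope b T c step (suc j) = begin
  T * b 0                                       ≤⟨ telescope b T c step j ⟩
  T * b j + j * j * c                           ≤⟨ +-monoˡ-≤ (j * j * c) (step j) ⟩
  T * b (suc j) + suc (j + j) * c + j * j * c   ≡⟨ odd-sum (T * b (suc j)) j c ⟩
  T * b (suc j) + suc j * suc j * c             ∎
  where
  open ≤-Reasoning
  odd-sum : ∀ a j c → a + (1 + (j + j)) * c + j * j * c ≡ a + (1 + j) * (1 + j) * c
  odd-sum = solve-∀

-- Read over ℚ: from y ≥ (1 - s/T) x and s/T ≤ 1/K follows y ≥ (1 - 1/K) x.
relative-deficit : ∀ T {K s x y} .{{_ : NonZero T}} →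
  T * x ≤ T * y + s * x → K * s ≤ T → (K ∸ 1) * x ≤ K * y
relative-deficit T {K} {s} {x} {y} Tx≤Ty+sx Ks≤T = begin
  (K ∸ 1) * x ≡⟨ *-distribʳ-∸ x K 1 ⟩
  K * x ∸ 1 * x ≡⟨ cong (K * x ∸_) (*-identityˡ x) ⟩
  K * x ∸ x ≤⟨ m≤n+o⇒m∸n≤o (K * x) x (*-cancelˡ-≤ T T[Kx]≤T[x+Ky]) ⟩
  K * y ∎
  where
  open ≤-Reasoning
  swap : ∀ a b c → a * (b * c) ≡ b * (a * c)
  swap = solve-∀
  expand : ∀ K T y s x → K * (T * y + s * x) ≡ T * (K * y) + K * s * x
  expand = solve-∀
  T[Kx]≤T[x+Ky] : T * (K * x) ≤ T * (x + K * y)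
  T[Kx]≤T[x+Ky] = begin
    T * (K * x)                   ≡⟨ swap T K x ⟩
    K * (T * x)                   ≤⟨ *-monoʳ-≤ K Tx≤Ty+sx ⟩
    K * (T * y + s * x)           ≡⟨ expand K T y s x ⟩
    T * (K * y) + K * s * x       ≤⟨ +-monoʳ-≤ (T * (K * y)) (*-monoˡ-≤ x Ks≤T) ⟩
    T * (K * y) + T * x           ≡⟨ +-comm (T * (K * y)) (T * x) ⟩
    T * x + T * (K * y)           ≡⟨ *-distribˡ-+ T x (K * y) ⟨
    T * (x + K * y)               ∎

[1+k]*[1+n]C[1+k]≡[1+n]*nCk : ∀ n k → suc k * (suc n C suc k) ≡ suc n * (n C k)
[1+k]*[1+n]C[1+k]≡[1+n]*nCk zero    zero    = refl
[1+k]*[1+n]C[1+k]≡[1+n]*nCk zero    (suc k) = *-zeroʳ (2 + k)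
[1+k]*[1+n]C[1+k]≡[1+n]*nCk (suc n) zero    =
  trans (*-identityˡ _) (trans (nC1≡n (2 + n)) (sym (*-identityʳ (2 + n))))
[1+k]*[1+n]C[1+k]≡[1+n]*nCk (suc n) (suc k) = begin
  (2 + k) * ((2 + n) C (2 + k))
    ≡⟨ cong ((2 + k) *_) (nCk+nC[k+1]≡[n+1]C[k+1] (suc n) (suc k)) ⟨
  (2 + k) * (A + B)
    ≡⟨ regroup k A B ⟩
  A + (suc k * A + (2 + k) * B)
    ≡⟨ cong (A +_) (cong₂ _+_ ([1+k]*[1+n]C[1+k]≡[1+n]*nCk n k) ([1+k]*[1+n]C[1+k]≡[1+n]*nCk n (suc k))) ⟩
  A + (suc n * (n C k) + suc n * (n C suc k))
    ≡⟨ cong (A +_) (*-distribˡ-+ (suc n) (n C k) (n C suc k)) ⟨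
  A + suc n * (n C k + n C suc k)
    ≡⟨ cong (λ t → A + suc n * t) (nCk+nC[k+1]≡[n+1]C[k+1] n k) ⟩
  (2 + n) * A ∎
  where
  open ≡-Reasoning
  A = suc n C suc k
  B = suc n C (2 + k)
  regroup : ∀ k a b → (2 + k) * (a + b) ≡ a + (suc k * a + (2 + k) * b)
  regroup = solve-∀

[1+k]*[nCk+nC[1+k]]≡[1+n]*nCk : ∀ n k → suc k * (n C k + n C suc k) ≡ suc n * (n C k)
[1+k]*[nCk+nC[1+k]]≡[1+n]*nCk n k =
  trans (cong (suc k *_) (nCk+nC[k+1]≡[n+1]C[k+1] n k)) ([1+k]*[1+n]C[1+k]≡[1+n]*nCk n k)

n≤1+k+k⇒nC[1+k]≤nCk : ∀ {n k} → n ≤ suc (k + k) → n C suc k ≤ n C k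
n≤1+k+k⇒nC[1+k]≤nCk {n} {k} n≤1+k+k = +-cancelˡ-≤ x y x (*-cancelˡ-≤ (suc k) (begin
  suc k * (x + y)       ≡⟨ [1+k]*[nCk+nC[1+k]]≡[1+n]*nCk n k ⟩
  suc n * x             ≤⟨ *-monoˡ-≤ x (s≤s (subst (n ≤_) (sym (+-suc k k)) n≤1+k+k)) ⟩
  (suc k + suc k) * x   ≡⟨ *-distribʳ-+ x (suc k) (suc k) ⟩
  suc k * x + suc k * x ≡⟨ *-distribˡ-+ (suc k) x x ⟨
  suc k * (x + x)       ∎))
  where
  open ≤-Reasoning
  x = n C k
  y = n C suc k

k+k≤n+d⇒[1+k]*nCk≤[1+k]*nC[1+k]+[1+d]*nCk : ∀ {n k d} → k + k ≤ n + d →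
  suc k * (n C k) ≤ suc k * (n C suc k) + suc d * (n C k)
k+k≤n+d⇒[1+k]*nCk≤[1+k]*nC[1+k]+[1+d]*nCk {n} {k} {d} k+k≤n+d = +-cancelˡ-≤ (suc k * x) _ _ (begin
  suc k * x + suc k * x                   ≡⟨ *-distribʳ-+ x (suc k) (suc k) ⟨
  (suc k + suc k) * x                     ≤⟨ *-monoˡ-≤ x 2+k+k≤2+n+d ⟩
  (suc n + suc d) * x                     ≡⟨ *-distribʳ-+ x (suc n) (suc d) ⟩
  suc n * x + suc d * x                   ≡⟨ cong (_+ suc d * x) ([1+k]*[nCk+nC[1+k]]≡[1+n]*nCk n k) ⟨
  suc k * (x + y) + suc d * x             ≡⟨ cong (_+ suc d * x) (*-distribˡ-+ (suc k) x y) ⟩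
  suc k * x + suc k * y + suc d * x       ≡⟨ +-assoc (suc k * x) (suc k * y) (suc d * x) ⟩
  suc k * x + (suc k * y + suc d * x)     ∎)
  where
  open ≤-Reasoning
  x = n C k
  y = n C suc k
  2+k+k≤2+n+d : suc k + suc k ≤ suc n + suc d
  2+k+k≤2+n+d = subst₂ _≤_ (sym (cong suc (+-suc k k))) (sym (cong suc (+-suc n d))) (s≤s (s≤s k+k≤n+d))

n*2≡n+n : ∀ n → n * 2 ≡ n + n
n*2≡n+n = solve-∀

n/2+n/2≤n : ∀ n → n / 2 + n / 2 ≤ n
n/2+n/2≤n n = subst (_≤ n) (n*2≡n+n (n / 2)) (m/n*n≤m n 2)

n≤1+n/2+n/2 : ∀ n → n ≤ suc (n / 2 + n / 2)
n≤1+n/2+n/2 n = begin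
  n                   ≡⟨ m≡m%n+[m/n]*n n 2 ⟩
  n % 2 + n / 2 * 2   ≤⟨ +-monoˡ-≤ (n / 2 * 2) (s≤s⁻¹ (m%n<n n 2)) ⟩
  suc (n / 2 * 2)     ≡⟨ cong suc (n*2≡n+n (n / 2)) ⟩
  suc (n / 2 + n / 2) ∎
  where open ≤-Reasoning

module Middle (n h : ℕ) (h+h≤n : h + h ≤ n) (n≤1+h+h : n ≤ suc (h + h)) where

  nC[1+h+i]≤nC[h+i] : ∀ i → n C suc (h + i) ≤ n C (h + i)
  nC[1+h+i]≤nC[h+i] i =
    n≤1+k+k⇒nC[1+k]≤nCk {n} {h + i} (≤-trans n≤1+h+h (s≤s (+-mono-≤ (m≤m+n h i) (m≤m+n h i))))

  nC[h+i]≤nCh : ∀ i → n C (h + i) ≤ n C h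
  nC[h+i]≤nCh zero    = ≤-reflexive (cong (n C_) (+-identityʳ h))
  nC[h+i]≤nCh (suc i) = begin
    n C (h + suc i) ≡⟨ cong (n C_) (+-suc h i) ⟩
    n C suc (h + i) ≤⟨ nC[1+h+i]≤nC[h+i] i ⟩
    n C (h + i)     ≤⟨ nC[h+i]≤nCh i ⟩
    n C h           ∎
    where open ≤-Reasoning

  deficit-step : ∀ i → suc h * (n C (h + i)) ≤ suc h * (n C (h + suc i)) + suc (i + i) * (n C h)
  deficit-step i = begin
    suc h * x                              ≤⟨ shrink-multiplier (s≤s (m≤m+n h i)) (nC[1+h+i]≤nC[h+i] i)
                                                 (k+k≤n+d⇒[1+k]*nCk≤[1+k]*nC[1+k]+[1+d]*nCk {n} {h + i} k+k≤n+i+i) ⟩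
    suc h * y + suc (i + i) * x            ≤⟨ +-monoʳ-≤ (suc h * y) (*-monoʳ-≤ (suc (i + i)) (nC[h+i]≤nCh i)) ⟩
    suc h * y + suc (i + i) * (n C h)        ≡⟨ cong (λ z → suc h * (n C z) + suc (i + i) * (n C h)) (+-suc h i) ⟨
    suc h * (n C (h + suc i)) + suc (i + i) * (n C h) ∎
    where
    open ≤-Reasoning
    x = n C (h + i)
    y = n C suc (h + i)
    rearrange : ∀ h i → (h + i) + (h + i) ≡ (h + h) + (i + i)
    rearrange = solve-∀
    k+k≤n+i+i : (h + i) + (h + i) ≤ n + (i + i)
    k+k≤n+i+i = subst (_≤ n + (i + i)) (sym (rearrange h i)) (+-monoˡ-≤ (i + i) h+h≤n)

  nCh-deficit : ∀ j → suc h * (n C h) ≤ suc h * (n C (h + j)) + j * j * (n C h)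
  nCh-deficit j = subst (λ z → suc h * (n C z) ≤ suc h * (n C (h + j)) + j * j * (n C h)) (+-identityʳ h)
    (telescope (λ i → n C (h + i)) (suc h) (n C h) deficit-step j)

  nCh-relative-deficit : ∀ {K j} → K * (j * j) ≤ suc h → (K ∸ 1) * (n C h) ≤ K * (n C (h + j))
  nCh-relative-deficit {K} {j} = relative-deficit (suc h) {K} {j * j} {n C h} {n C (h + j)} (nCh-deficit j)

layer : (n r : ℕ) → List (Subset n)
layer zero    zero    = [ [] ]
layer zero    (suc r) = []
layer (suc n) zero    = map (outside ∷_) (layer n zero)
layer (suc n) (suc r) = map (inside ∷_) (layer n r) ++ map (outside ∷_) (layer n (suc r))

∈-layer⇒∣p∣≡r : ∀ n r {p} → p ∈ layer n r → ∣ p ∣ ≡ r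
∈-layer⇒∣p∣≡r zero    zero    (here refl) = refl
∈-layer⇒∣p∣≡r (suc n) zero    p∈ with ∈-map⁻ (outside ∷_) p∈
... | q , q∈ , refl = ∈-layer⇒∣p∣≡r n zero q∈
∈-layer⇒∣p∣≡r (suc n) (suc r) p∈ with ∈-++⁻ (map (inside ∷_) (layer n r)) p∈
... | inj₁ p∈ᵢ with ∈-map⁻ (inside ∷_) p∈ᵢ
...   | q , q∈ , refl = cong suc (∈-layer⇒∣p∣≡r n r q∈)
∈-layer⇒∣p∣≡r (suc n) (suc r) p∈ | inj₂ p∈ₒ with ∈-map⁻ (outside ∷_) p∈ₒ
...   | q , q∈ , refl = ∈-layer⇒∣p∣≡r n (suc r) q∈

∷-injectiveʳ : ∀ {n} {b : Bool} {p q : Subset n} → b ∷ p ≡ b ∷ q → p ≡ q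
∷-injectiveʳ refl = refl

layer-unique : ∀ n r → Unique (layer n r)
layer-unique zero    zero    = All.[] AllPairs.∷ AllPairs.[]
layer-unique zero    (suc r) = AllPairs.[]
layer-unique (suc n) zero    = map⁺ ∷-injectiveʳ (layer-unique n zero)
layer-unique (suc n) (suc r) =
  ++⁺ (map⁺ ∷-injectiveʳ (layer-unique n r)) (map⁺ ∷-injectiveʳ (layer-unique n (suc r))) disjoint
  where
  disjoint : ∀ {p} → ¬ (p ∈ map (inside ∷_) (layer n r) × p ∈ map (outside ∷_) (layer n (suc r)))
  disjoint (p∈ᵢ , p∈ₒ) with ∈-map⁻ (inside ∷_) p∈ᵢ | ∈-map⁻ (outside ∷_) p∈ₒ
  ... | _ , _ , refl | _ , _ , ()

length-layer : ∀ n r → length (layer n r) ≡ n C r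
length-layer zero    zero    = refl
length-layer zero    (suc r) = refl
length-layer (suc n) zero    = trans (length-map (outside ∷_) (layer n zero)) (length-layer n zero)
length-layer (suc n) (suc r) = begin
  length (map (inside ∷_) (layer n r) ++ map (outside ∷_) (layer n (suc r)))
    ≡⟨ length-++ (map (inside ∷_) (layer n r)) ⟩
  length (map (inside ∷_) (layer n r)) + length (map (outside ∷_) (layer n (suc r)))
    ≡⟨ cong₂ _+_ (length-map (inside ∷_) (layer n r)) (length-map (outside ∷_) (layer n (suc r))) ⟩
  length (layer n r) + length (layer n (suc r))
    ≡⟨ cong₂ _+_ (length-layer n r) (length-layer n (suc r)) ⟩
  n C r + n C suc r
    ≡⟨ nCk+nC[k+1]≡[n+1]C[k+1] n r ⟩
  suc n C suc r ∎
  where open ≡-Reasoning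

layers : (n r L : ℕ) → List (Subset n)
layers n r zero    = []
layers n r (suc L) = layers n r L ++ layer n (r + L)

∈-layers⇒r≤∣p∣<r+L : ∀ n r L {p} → p ∈ layers n r L → r ≤ ∣ p ∣ × ∣ p ∣ < r + L
∈-layers⇒r≤∣p∣<r+L n r (suc L) p∈ with ∈-++⁻ (layers n r L) p∈
... | inj₁ p∈ˡ = map₂ (λ ∣p∣<r+L → ≤-trans ∣p∣<r+L (+-monoʳ-≤ r (n≤1+n L))) (∈-layers⇒r≤∣p∣<r+L n r L p∈ˡ)
... | inj₂ p∈ʳ rewrite ∈-layer⇒∣p∣≡r n (r + L) p∈ʳ = m≤m+n r L , ≤-reflexive (sym (+-suc r L))

layers-unique : ∀ n r L → Unique (layers n r L)
layers-unique n r zero    = AllPairs.[]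
layers-unique n r (suc L) = ++⁺ (layers-unique n r L) (layer-unique n (r + L)) disjoint
  where
  disjoint : ∀ {p} → ¬ (p ∈ layers n r L × p ∈ layer n (r + L))
  disjoint (p∈ˡ , p∈ʳ) = <-irrefl (∈-layer⇒∣p∣≡r n (r + L) p∈ʳ) (proj₂ (∈-layers⇒r≤∣p∣<r+L n r L p∈ˡ))

*-length-layers-≥ : ∀ n r L K c → (∀ j → j < L → c ≤ K * (n C (r + j))) →
  L * c ≤ K * length (layers n r L)
*-length-layers-≥ n r zero    K c c≤ = z≤n
*-length-layers-≥ n r (suc L) K c c≤ = begin
  c + L * c
    ≤⟨ +-mono-≤ (c≤ L ≤-refl) (*-length-layers-≥ n r L K c (λ j j<L → c≤ j (m<n⇒m<1+n j<L))) ⟩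
  K * (n C (r + L)) + K * length (layers n r L)
    ≡⟨ +-comm (K * (n C (r + L))) _ ⟩
  K * length (layers n r L) + K * (n C (r + L))
    ≡⟨ *-distribˡ-+ K (length (layers n r L)) (n C (r + L)) ⟨
  K * (length (layers n r L) + n C (r + L))
    ≡⟨ cong (λ z → K * (length (layers n r L) + z)) (length-layer n (r + L)) ⟨
  K * (length (layers n r L) + length (layer n (r + L)))
    ≡⟨ cong (K *_) (length-++ (layers n r L)) ⟨
  K * length (layers n r (suc L)) ∎
  where open ≤-Reasoning

middle-layers-length-≥ : ∀ n h L k → h + h ≤ n → n ≤ suc (h + h) → L * suc k * (L * L) ≤ suc h →
  (L * suc k ∸ 1) * (n C h) ≤ suc k * length (layers n h L)
middle-layers-length-≥ n h zero      k _     _       _   = z≤n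
middle-layers-length-≥ n h L@(suc _) k h+h≤n n≤1+h+h KL²≤1+h = *-cancelˡ-≤ L (begin
  L * ((K ∸ 1) * (n C h))         ≤⟨ *-length-layers-≥ n h L K ((K ∸ 1) * (n C h)) near-middle ⟩
  K * length (layers n h L)       ≡⟨ *-assoc L (suc k) (length (layers n h L)) ⟩
  L * (suc k * length (layers n h L)) ∎)
  where
  open ≤-Reasoning
  K = L * suc k
  near-middle : ∀ j → j < L → (K ∸ 1) * (n C h) ≤ K * (n C (h + j))
  near-middle j j<L = Middle.nCh-relative-deficit n h h+h≤n n≤1+h+h {K}
    (≤-trans (*-monoʳ-≤ K (*-mono-≤ (<⇒≤ j<L) (<⇒≤ j<L))) KL²≤1+h)

-- Induced copies of H_m span m levels

∪-lub : ∀ {n} {p q r : Subset n} → p ⊆ r → q ⊆ r → p ∪ q ⊆ r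
∪-lub {p = p} {q} p⊆r q⊆r x∈p∪q with x∈p∪q⁻ p q x∈p∪q
... | inj₁ x∈p = p⊆r x∈p
... | inj₂ x∈q = q⊆r x∈q

p⊆q∧q⊈p⇒∣p∣<∣q∣ : ∀ {n} {p q : Subset n} → p ⊆ q → ¬ (q ⊆ p) → ∣ p ∣ < ∣ q ∣
p⊆q∧q⊈p⇒∣p∣<∣q∣ {p = []}          {[]}          _   q⊈p = ⊥-elim (q⊈p (λ x∈q → x∈q))
p⊆q∧q⊈p⇒∣p∣<∣q∣ {p = outside ∷ p} {outside ∷ q} p⊆q q⊈p =
  p⊆q∧q⊈p⇒∣p∣<∣q∣ (drop-∷-⊆ p⊆q) (λ q⊆p → q⊈p (s⊆s q⊆p))
p⊆q∧q⊈p⇒∣p∣<∣q∣ {p = outside ∷ p} {inside  ∷ q} p⊆q _   = s≤s (p⊆q⇒∣p∣≤∣q∣ (drop-∷-⊆ p⊆q))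
p⊆q∧q⊈p⇒∣p∣<∣q∣ {p = inside  ∷ p} {outside ∷ q} p⊆q _   with p⊆q here
... | ()
p⊆q∧q⊈p⇒∣p∣<∣q∣ {p = inside  ∷ p} {inside  ∷ q} p⊆q q⊈p =
  s≤s (p⊆q∧q⊈p⇒∣p∣<∣q∣ (drop-∷-⊆ p⊆q) (λ q⊆p → q⊈p (s⊆s q⊆p)))

module _ {n L : ℕ} {f : Fin (suc L) ⊎ Fin (suc L) → Subset n}
         (f-induced : ∀ u v → HLe (suc L) u v ⇔ (f u ⊆ f v)) where

  private
    x y : Fin (suc L) → Subset n
    x i = f (inj₁ i)
    y j = f (inj₂ j)

    x⊆y : ∀ {i j} → i Fin.≤ j → x i ⊆ y j
    x⊆y i≤j = Equivalence.to (f-induced _ _) (le-xy i≤j)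

    x⊈y : ∀ {i j} → j Fin.< i → ¬ (x i ⊆ y j)
    x⊈y j<i xi⊆yj with Equivalence.from (f-induced _ _) xi⊆yj
    ... | le-xy i≤j = <⇒≱ j<i i≤j

    -- The witness J is x₀ ∪ … ∪ x_j; it grows strictly because x_{j+1} ⊈ y_j ⊇ J.
    union-chain : ∀ j → j ≤ L →
      Σ[ J ∈ Subset n ] (∣ x Fin.zero ∣ + j ≤ ∣ J ∣ × (∀ l → j ≤ toℕ l → J ⊆ y l))
    union-chain zero    _     = x Fin.zero , ≤-reflexive (+-identityʳ _) , λ _ _ → x⊆y z≤n
    union-chain (suc j) 1+j≤L with union-chain j (≤-trans (n≤1+n j) 1+j≤L)
    ... | J , ∣x₀∣+j≤∣J∣ , J⊆y = J ∪ x i , ∣x₀∣+1+j≤∣J∪xᵢ∣ , J∪xᵢ⊆y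
      where
      i = fromℕ< (s≤s 1+j≤L)
      l = fromℕ< (s≤s (≤-trans (n≤1+n j) 1+j≤L))
      toℕ-i = toℕ-fromℕ< (s≤s 1+j≤L)
      toℕ-l = toℕ-fromℕ< (s≤s (≤-trans (n≤1+n j) 1+j≤L))
      J∪xᵢ⊆y : ∀ l′ → suc j ≤ toℕ l′ → J ∪ x i ⊆ y l′
      J∪xᵢ⊆y l′ 1+j≤l′ = ∪-lub (J⊆y l′ (≤-trans (n≤1+n j) 1+j≤l′)) (x⊆y (subst (_≤ toℕ l′) (sym toℕ-i) 1+j≤l′))
      J∪xᵢ⊈J : ¬ (J ∪ x i ⊆ J)
      J∪xᵢ⊈J J∪xᵢ⊆J = x⊈y (subst₂ _<_ (sym toℕ-l) (sym toℕ-i) ≤-refl)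
        (⊆-trans (⊆-trans (q⊆p∪q J (x i)) J∪xᵢ⊆J) (J⊆y l (≤-reflexive (sym toℕ-l))))
      ∣x₀∣+1+j≤∣J∪xᵢ∣ : ∣ x Fin.zero ∣ + suc j ≤ ∣ J ∪ x i ∣
      ∣x₀∣+1+j≤∣J∪xᵢ∣ = begin
        ∣ x Fin.zero ∣ + suc j   ≡⟨ +-suc ∣ x Fin.zero ∣ j ⟩
        suc (∣ x Fin.zero ∣ + j) ≤⟨ s≤s ∣x₀∣+j≤∣J∣ ⟩
        suc ∣ J ∣                ≤⟨ p⊆q∧q⊈p⇒∣p∣<∣q∣ (p⊆p∪q (x i)) J∪xᵢ⊈J ⟩
        ∣ J ∪ x i ∣              ∎
        where open ≤-Reasoning

  induced-H⇒∣x₀∣+L≤∣y_L∣ : ∣ f (inj₁ Fin.zero) ∣ + L ≤ ∣ f (inj₂ (fromℕ L)) ∣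
  induced-H⇒∣x₀∣+L≤∣y_L∣ with union-chain L ≤-refl
  ... | J , ∣x₀∣+L≤∣J∣ , J⊆y =
    ≤-trans ∣x₀∣+L≤∣J∣ (p⊆q⇒∣p∣≤∣q∣ (J⊆y (fromℕ L) (≤-reflexive (sym (toℕ-fromℕ L)))))

levels⇒H-free : ∀ {n} r L {F : List (Subset n)} → (∀ {p} → p ∈ F → r ≤ ∣ p ∣ × ∣ p ∣ < r + L) →
  ¬ InducedIn (HLe (suc L)) F
levels⇒H-free r L F-levels (f , f∈F , _ , f-induced) = <-irrefl refl (begin-strict
  r + L                         ≤⟨ +-monoˡ-≤ L (proj₁ (F-levels (f∈F (inj₁ Fin.zero)))) ⟩
  ∣ f (inj₁ Fin.zero) ∣ + L     ≤⟨ induced-H⇒∣x₀∣+L≤∣y_L∣ f-induced ⟩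
  ∣ f (inj₂ (fromℕ L)) ∣        <⟨ proj₂ (F-levels (f∈F (inj₂ (fromℕ L)))) ⟩
  r + L                         ∎)
  where open ≤-Reasoning

mainTheorem11 : (m : ℕ) → 1 ≤ m → (k : ℕ) →
    ∃[ N ] ((n : ℕ) → N ≤ n →
    LaStarScaled≥ (HLe m) n k (((m ∸ 1) * suc k ∸ 1) * (n C (n / 2))))
mainTheorem11 (suc L) _ k = X * 2 , λ n 2X≤n →
    layers n (n / 2) L
  , layers-unique n (n / 2) L
  , levels⇒H-free (n / 2) L (∈-layers⇒r≤∣p∣<r+L n (n / 2) L)
  , middle-layers-length-≥ n (n / 2) L k (n/2+n/2≤n n) (n≤1+n/2+n/2 n) (X≤1+n/2 2X≤n)
  where
  X = L * suc k * (L * L)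
  X≤1+n/2 : ∀ {n} → X * 2 ≤ n → X ≤ suc (n / 2)
  X≤1+n/2 {n} 2X≤n = m≤n⇒m≤1+n (subst (_≤ n / 2) (m*n/n≡m X 2) (/-monoˡ-≤ 2 2X≤n))
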